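{- Let $\alpha\ge 5/3$. Let $G$ be an instance of MAP, let $v$ be a cut node of $G$, and let $B_1,\dots,B_k$ be the 2ec-$v$-blocks of $G$. Let $B'_1,\dots,B'_k$ be 2-ECSSs of $B_1,\dots,B_k$, respectively, such that $\mathrm{cost}(B'_i)\le\max(\mathrm{opt}(B_i),\ \alpha\,\mathrm{opt}(B_i)-2)$ for all $i\in[k]$. Then $B'_1\cup\dots\cup B'_k$ is a 2-ECSS of $G$ of cost at most $\max(\mathrm{opt}(G),\ \alpha\,\mathrm{opt}(G)-2)$.
   Context: An instance of MAP is a loop-free, 2-edge connected multigraph with edge costs in $\{0,1\}$ whose cost-$0$ edges form a matching. A graph is 2-edge connected if it has at least $2$ nodes and is connected after deleting any single edge. A 2-ECSS of a graph is a 2-edge connected spanning subgraph, and $\mathrm{opt}(\cdot)$ is the minimum cost of a 2-ECSS. A cut node is a node whose deletion disconnects the graph. For a cut node $v$ of a 2-edge connected graph $G$, a 2ec-$v$-block of $G$ is the subgraph induced by $\{v\}\cup V(C)$ for a connected component $C$ of $G-v$.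
   Formalization: The parameter α ranges over the rationals with α ≥ 5/3, rather than over the real numbers. -}

module Defs where

open import Data.Nat using (ℕ; zero; suc; _≤_)
open import Data.Bool using (Bool; true; false; if_then_else_; _∧_)
open import Data.Fin using (Fin)
open import Data.Fin.Subset using (Subset; _∈_; _∉_; _⊆_; ⊤; ∁; ⁅_⁆; _∪_; _-_; ⋃)
open import Data.Vec using (Vec; lookup; tabulate; sum)
import Data.List as List
open import Data.Product using (Σ; ∃; ∃-syntax; _×_; _,_; proj₁; proj₂)
open import Data.Sum using (_⊎_)
open import Relation.Binary.PropositionalEquality using (_≡_; _≢_)
open import Relation.Nullary using (¬_)
open import Data.Integer using (+_)
open import Data.Rational as ℚ using (ℚ; _/_)
open import Data.Fin using (_≟_)
open import Relation.Nullary.Decidable using (⌊_⌋)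

-- A multigraph on node set Fin n with m edges (edges are indexed by Fin m,
-- so parallel edges are distinct indices); ends e = (endpoints of e);
-- cst e = cost of edge e.  A subgraph is described by a node set U : Subset n
-- and an edge set S : Subset m.
module Graph {n m : ℕ} (ends : Fin m → Fin n × Fin n) (cst : Fin m → ℕ) where

  src tgt : Fin m → Fin n
  src e = proj₁ (ends e)
  tgt e = proj₂ (ends e)

  data Reach (S : Subset m) (x : Fin n) : Fin n → Set where
    here : Reach S x x
    fwd  : ∀ e → e ∈ S → Reach S x (src e) → Reach S x (tgt e)
    bwd  : ∀ e → e ∈ S → Reach S x (tgt e) → Reach S x (src e)

  Connected : Subset n → Subset m → Set
  Connected U S = ∀ x y → x ∈ U → y ∈ U → Reach S x y

  EdgesIn : Subset n → Subset m → Set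
  EdgesIn U S = ∀ e → e ∈ S → src e ∈ U × tgt e ∈ U

  TwoEC : Subset n → Subset m → Set
  TwoEC U S =
    EdgesIn U S ×
    (∃[ x ] ∃[ y ] (x ∈ U × y ∈ U × x ≢ y)) ×
    Connected U S ×
    (∀ e → e ∈ S → Connected U (S - e))

  cost : Subset m → ℕ
  cost S = sum (tabulate (λ e → if lookup S e then cst e else 0))

  IsTwoECSS : Subset n → Subset m → Subset m → Set
  IsTwoECSS U S T = T ⊆ S × TwoEC U T

  IsOpt : Subset n → Subset m → ℕ → Set
  IsOpt U S o =
    (∃[ T ] (IsTwoECSS U S T × cost T ≡ o)) ×
    (∀ T → IsTwoECSS U S T → o ≤ cost T)

  IsMAP : Set
  IsMAP =
    (∀ e → src e ≢ tgt e) ×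
    (∀ e → cst e ≡ 0 ⊎ cst e ≡ 1) ×
    (∀ e f → e ≢ f → cst e ≡ 0 → cst f ≡ 0 →
       src e ≢ src f × src e ≢ tgt f × tgt e ≢ src f × tgt e ≢ tgt f) ×
    TwoEC ⊤ ⊤

  edgesAvoiding : Fin n → Subset m
  edgesAvoiding v = tabulate (λ e → if ⌊ src e ≟ v ⌋ then false
                                     else if ⌊ tgt e ≟ v ⌋ then false else true)

  IsCutNode : Fin n → Set
  IsCutNode v = ∃[ x ] ∃[ y ] (x ≢ v × y ≢ v × ¬ Reach (edgesAvoiding v) x y)

  IsComponent : Fin n → Subset n → Set
  IsComponent v C =
    v ∉ C ×
    (∃[ x ] x ∈ C) ×
    Connected C (edgesAvoiding v) ×
    (∀ x y → x ∈ C → Reach (edgesAvoiding v) x y → y ∈ C)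

  inducedEdges : Subset n → Subset m
  inducedEdges U = tabulate (λ e → lookup U (src e) ∧ lookup U (tgt e))

  -- node set of the 2ec-v-block for component C
  blockNodes : Fin n → Subset n → Subset n
  blockNodes v C = ⁅ v ⁆ ∪ C

  EnumComponents : Fin n → (k : ℕ) → (Fin k → Subset n) → Set
  EnumComponents v k C =
    (∀ i → IsComponent v (C i)) ×
    (∀ i j → C i ≡ C j → i ≡ j) ×
    (∀ x → x ≢ v → ∃[ i ] x ∈ C i)

  ⋃ᶠ : {k : ℕ} → (Fin k → Subset m) → Subset m
  ⋃ᶠ {k} S = ⋃ (List.tabulate S)

fromℕ : ℕ → ℚ
fromℕ c = + c / 1

bound : ℚ → ℕ → ℚ
bound α o = fromℕ o ℚ.⊔ (α ℚ.* fromℕ o ℚ.- fromℕ 2)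

module Submission where

-- Write E(Bᵢ) for the edge set of Bᵢ.
--  * Union.  Every node x ≠ v lies in some block and is joined to v there,
--    also after deleting any single edge; hence ⋃ B'ᵢ is a 2-ECSS of G.
--  * Restriction.  Projecting every node outside a block Bᵢ onto v maps each
--    edge of a spanning subgraph T of G to a walk in T ∩ E(Bᵢ), because an
--    edge leaving a block leaves it at v.  So T ∩ E(Bᵢ) is a 2-ECSS of Bᵢ
--    whenever T is a 2-ECSS of G; as G is loop-free the sets E(Bᵢ) are
--    pairwise disjoint, and therefore  Σ optᵢ ≤ opt(G).
--  * Arithmetic.  For α ≥ 1 the bound x ↦ max(x , α x - c) (c ≥ 0) is
--    monotone and superadditive on x ≥ 0, hence
--      cost (⋃ B'ᵢ) ≤ Σ cost B'ᵢ ≤ bound (Σ optᵢ) ≤ bound opt(G).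

open import Defs
open import Data.Nat using (ℕ)
open import Data.Fin using (Fin)
open import Data.Fin.Subset using (Subset; ⊤)
open import Data.Product using (Σ; ∃; ∃-syntax; _×_; _,_)
open import Data.Integer using (+_)
open import Data.Rational using (ℚ; _≤_; _/_)

import Data.Nat as ℕ
import Data.Nat.Properties as ℕ
import Data.Integer as ℤ
import Data.Integer.Properties as ℤ
import Data.Rational as ℚ
import Data.Rational.Properties as ℚ
import Data.Rational.Unnormalised as ℚᵘ
import Data.Rational.Unnormalised.Properties as ℚᵘ
import Data.Nat.Coprimality as Coprimality
open import Data.Fin using (zero; suc; _≟_)
open import Data.Vec using (_∷_; here; there; lookup; tabulate; sum)
open import Data.Vec.Properties using (tabulate-cong; lookup∘tabulate; lookup-zipWith; lookup-replicate; []=⇒lookup; lookup⇒[]=)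
open import Data.Bool using (true; false; if_then_else_; _∧_; _∨_)
open import Data.Bool.Properties using (∧-conicalˡ; ∧-conicalʳ)
open import Data.Sum using (inj₁; inj₂)
open import Data.Empty using (⊥-elim)
open import Function using (_∘_)
open import Relation.Nullary using (yes; no)
open import Relation.Nullary.Decidable using (⌊_⌋)
open import Relation.Binary.PropositionalEquality
  using (_≡_; _≢_; refl; sym; trans; cong; cong₂; subst; subst₂; module ≡-Reasoning)
open import Algebra.Properties.CommutativeSemigroup ℕ.+-commutativeSemigroup using (interchange)
open import Data.Product using (proj₁; proj₂)

∑ : ∀ {k} → (Fin k → ℕ) → ℕ
∑ f = sum (tabulate f)

∑-mono : ∀ {k} {f g : Fin k → ℕ} → (∀ i → f i ℕ.≤ g i) → ∑ f ℕ.≤ ∑ g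
∑-mono {ℕ.zero}  f≤g = ℕ.z≤n
∑-mono {ℕ.suc k} f≤g = ℕ.+-mono-≤ (f≤g zero) (∑-mono (f≤g ∘ suc))

∑-+ : ∀ {k} (f g : Fin k → ℕ) → ∑ (λ i → f i ℕ.+ g i) ≡ ∑ f ℕ.+ ∑ g
∑-+ {ℕ.zero}  f g = refl
∑-+ {ℕ.suc k} f g = trans (cong ((f zero ℕ.+ g zero) ℕ.+_) (∑-+ (f ∘ suc) (g ∘ suc)))
                          (interchange (f zero) (g zero) (∑ (f ∘ suc)) (∑ (g ∘ suc)))

∑-zero : ∀ {k} → ∑ {k} (λ _ → 0) ≡ 0
∑-zero {ℕ.zero}  = refl
∑-zero {ℕ.suc k} = ∑-zero {k}

module CostBound where
  open import Data.Rational using (mkℚ; 0ℚ; 1ℚ; _+_; _*_; _-_; -_; _⊔_; nonNegative; *≤*)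
  open import Data.Rational.Properties
    using ( normalize-coprime; toℚᵘ-injective; toℚᵘ-homo-+
            ; +-mono-≤; +-monoʳ-≤; +-monoˡ-≤; *-monoʳ-≤-nonNeg; *-monoˡ-≤-nonNeg
            ; *-identityˡ; *-distribˡ-+; +-assoc; +-comm; +-identityʳ; neg-antimono-≤
            ; ⊔-sel; ⊔-mono-≤; p≤p⊔q; p≤q⇒p≤r⊔q; module ≤-Reasoning)

  maxAffine : ℚ → ℚ → ℚ → ℚ
  maxAffine α c x = x ⊔ (α * x - c)

  +-⊔-lub : ∀ {x y z w r} → x + z ≤ r → x + w ≤ r → y + z ≤ r → y + w ≤ r → (x ⊔ y) + (z ⊔ w) ≤ r
  +-⊔-lub {x} {y} {z} {w} xz xw yz yw with ⊔-sel x y | ⊔-sel z w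
  ... | inj₁ eq₁ | inj₁ eq₂ rewrite eq₁ | eq₂ = xz
  ... | inj₁ eq₁ | inj₂ eq₂ rewrite eq₁ | eq₂ = xw
  ... | inj₂ eq₁ | inj₁ eq₂ rewrite eq₁ | eq₂ = yz
  ... | inj₂ eq₁ | inj₂ eq₂ rewrite eq₁ | eq₂ = yw

  x≤α*x : ∀ {α x} → 1ℚ ≤ α → 0ℚ ≤ x → x ≤ α * x
  x≤α*x {α} {x} 1≤α 0≤x =
    subst (_≤ α * x) (*-identityˡ x) (*-monoʳ-≤-nonNeg x {{nonNegative 0≤x}} 1≤α)

  x-c≤x : ∀ x {c} → 0ℚ ≤ c → x - c ≤ x
  x-c≤x x 0≤c = subst (x - _ ≤_) (+-identityʳ x) (+-monoʳ-≤ x (neg-antimono-≤ 0≤c))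

  maxAffine-superadditive : ∀ {α c x y} → 1ℚ ≤ α → 0ℚ ≤ c → 0ℚ ≤ x → 0ℚ ≤ y →
    maxAffine α c x + maxAffine α c y ≤ maxAffine α c (x + y)
  maxAffine-superadditive {α} {c} {x} {y} 1≤α 0≤c 0≤x 0≤y =
    +-⊔-lub {x} {α * x - c} {y} {α * y - c} (p≤p⊔q (x + y) _)
            (toAffine (+-monoˡ-≤ (α * y - c) (x≤α*x 1≤α 0≤x)))
            (toAffine (subst (α * x - c + y ≤_) (sym split₂) (+-monoʳ-≤ (α * x - c) (x≤α*x 1≤α 0≤y))))
            (toAffine (subst (α * x - c + (α * y - c) ≤_) (sym split₂) (+-monoʳ-≤ (α * x - c) (x-c≤x (α * y) 0≤c))))
    where
    open ≡-Reasoning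
    split₁ : α * (x + y) - c ≡ α * x + (α * y - c)
    split₁ = trans (cong (_- c) (*-distribˡ-+ α x y)) (+-assoc (α * x) (α * y) (- c))
    split₂ : α * x + (α * y - c) ≡ α * x - c + α * y
    split₂ = begin
      α * x + (α * y - c)  ≡⟨ cong (λ t → α * x + t) (+-comm (α * y) (- c)) ⟩
      α * x + (- c + α * y) ≡⟨ sym (+-assoc (α * x) (- c) (α * y)) ⟩
      α * x - c + α * y     ∎
    toAffine : ∀ {r} → r ≤ α * x + (α * y - c) → r ≤ maxAffine α c (x + y)
    toAffine r≤ = p≤q⇒p≤r⊔q (x + y) (subst (_ ≤_) (sym split₁) r≤)

  coprime-1 : ∀ c → Coprimality.Coprime c 1
  coprime-1 c = Coprimality.sym (Coprimality.1-coprimeTo c)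

  fromℕ≡mkℚ : ∀ c → fromℕ c ≡ mkℚ (+ c) 0 (coprime-1 c)
  fromℕ≡mkℚ c = normalize-coprime (coprime-1 c)

  fromℕ-mono : ∀ {a b} → a ℕ.≤ b → fromℕ a ≤ fromℕ b
  fromℕ-mono {a} {b} a≤b rewrite fromℕ≡mkℚ a | fromℕ≡mkℚ b =
    *≤* (subst₂ ℤ._≤_ (sym (ℤ.*-identityʳ (+ a))) (sym (ℤ.*-identityʳ (+ b))) (ℤ.+≤+ a≤b))

  fromℕ-+ : ∀ a b → fromℕ (a ℕ.+ b) ≡ fromℕ a + fromℕ b
  fromℕ-+ a b rewrite fromℕ≡mkℚ a | fromℕ≡mkℚ b | fromℕ≡mkℚ (a ℕ.+ b) =
    toℚᵘ-injective (ℚᵘ.≃-trans (ℚᵘ.*≡* cross) (ℚᵘ.≃-sym (toℚᵘ-homo-+ (mkℚ (+ a) 0 (coprime-1 a)) (mkℚ (+ b) 0 (coprime-1 b)))))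
    where
    cross : + (a ℕ.+ b) ℤ.* + 1 ≡ (+ a ℤ.* + 1 ℤ.+ + b ℤ.* + 1) ℤ.* + 1
    cross rewrite ℤ.*-identityʳ (+ a) | ℤ.*-identityʳ (+ b) | ℤ.*-identityʳ (+ a ℤ.+ + b) = ℤ.pos-+ a b

  0≤fromℕ : ∀ a → 0ℚ ≤ fromℕ a
  0≤fromℕ a = fromℕ-mono {0} {a} ℕ.z≤n

  bound-mono : ∀ {α} → 0ℚ ≤ α → ∀ {a b} → a ℕ.≤ b → bound α a ≤ bound α b
  bound-mono {α} 0≤α a≤b =
    ⊔-mono-≤ (fromℕ-mono a≤b) (+-monoˡ-≤ _ (*-monoˡ-≤-nonNeg α {{nonNegative 0≤α}} (fromℕ-mono a≤b)))

  bound-superadditive : ∀ {α} → 1ℚ ≤ α → ∀ a b → bound α a + bound α b ≤ bound α (a ℕ.+ b)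
  bound-superadditive {α} 1≤α a b =
    subst (λ s → bound α a + bound α b ≤ maxAffine α (fromℕ 2) s) (sym (fromℕ-+ a b))
          (maxAffine-superadditive 1≤α (0≤fromℕ 2) (0≤fromℕ a) (0≤fromℕ b))

  bound-∑ : ∀ {α} → 1ℚ ≤ α → ∀ {k} (x y : Fin k → ℕ) →
    (∀ i → fromℕ (x i) ≤ bound α (y i)) → fromℕ (∑ x) ≤ bound α (∑ y)
  bound-∑ {α} 1≤α {ℕ.zero} x y x≤y = p≤p⊔q (fromℕ 0) (α * fromℕ 0 - fromℕ 2)
  bound-∑ {α} 1≤α {ℕ.suc k} x y x≤y = begin
    fromℕ (x zero ℕ.+ ∑ (x ∘ suc))         ≡⟨ fromℕ-+ (x zero) (∑ (x ∘ suc)) ⟩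
    fromℕ (x zero) + fromℕ (∑ (x ∘ suc))    ≤⟨ +-mono-≤ (x≤y zero) (bound-∑ 1≤α (x ∘ suc) (y ∘ suc) (x≤y ∘ suc)) ⟩
    bound α (y zero) + bound α (∑ (y ∘ suc)) ≤⟨ bound-superadditive 1≤α (y zero) (∑ (y ∘ suc)) ⟩
    bound α (y zero ℕ.+ ∑ (y ∘ suc))       ∎
    where open ≤-Reasoning

-- (Subset's _-_ is opened only here, after the rational section, as it clashes with ℚ's.)
open import Data.Fin.Subset
  using (_∈_; _∉_; _⊆_; _∪_; _∩_; _─_; _-_; ⊥; ⁅_⁆; inside; outside)
open import Data.Fin.Subset.Properties
  using ( _∈?_; ∈⊤; ⊆⊤; x∈p∪q⁺; x∈p∪q⁻; x∈p∩q⁺; x∈p∩q⁻; p∩q⊆p; p∩q⊆q; p─q⊆p; x∈p∧x≢y⇒x∈p-y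
        ; x∉⁅y⁆⇒x≢y; x∈⁅x⁆; ∉⊥; x∈⁅y⁆⇒x≡y; Empty-unique; ⊆-antisym)

∈⇒lookup : ∀ {k} {p : Subset k} {x} → x ∈ p → lookup p x ≡ true
∈⇒lookup = []=⇒lookup

lookup⇒∈ : ∀ {k} {p : Subset k} {x} → lookup p x ≡ true → x ∈ p
lookup⇒∈ {p = p} {x} = lookup⇒[]= x p


x∈p─q⇒x∉q : ∀ {k} (p q : Subset k) {x} → x ∈ p ─ q → x ∉ q
x∈p─q⇒x∉q (inside ∷ p) (outside ∷ q) here ()
x∈p─q⇒x∉q (_ ∷ p) (_ ∷ q) (there x∈p─q) (there x∈q) = x∈p─q⇒x∉q p q x∈p─q x∈q

x∈p-y⇒x≢y : ∀ {k} {p : Subset k} {x y} → x ∈ p - y → x ≢ y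
x∈p-y⇒x≢y {p = p} {y = y} x∈p-y = x∉⁅y⁆⇒x≢y (x∈p─q⇒x∉q p ⁅ y ⁆ x∈p-y)

-‿monoˡ : ∀ {k} {p q : Subset k} {y} → p ⊆ q → p - y ⊆ q - y
-‿monoˡ {p = p} {y = y} p⊆q x∈p-y = x∈p∧x≢y⇒x∈p-y (p⊆q (p─q⊆p p ⁅ y ⁆ x∈p-y)) (x∈p-y⇒x≢y x∈p-y)

-∩⊆∩- : ∀ {k} (p q : Subset k) y → (p - y) ∩ q ⊆ (p ∩ q) - y
-∩⊆∩- p q y x∈ with x∈p∩q⁻ (p - y) q x∈
... | x∈p-y , x∈q = x∈p∧x≢y⇒x∈p-y (x∈p∩q⁺ (p─q⊆p p ⁅ y ⁆ x∈p-y , x∈q)) (x∈p-y⇒x≢y x∈p-y)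

module GraphFacts {n m : ℕ} (ends : Fin m → Fin n × Fin n) (cst : Fin m → ℕ) where
  open Graph ends cst

  reach-mono : ∀ {S T x y} → S ⊆ T → Reach S x y → Reach T x y
  reach-mono S⊆T here          = here
  reach-mono S⊆T (fwd e e∈S r) = fwd e (S⊆T e∈S) (reach-mono S⊆T r)
  reach-mono S⊆T (bwd e e∈S r) = bwd e (S⊆T e∈S) (reach-mono S⊆T r)

  reach-trans : ∀ {S x y z} → Reach S x y → Reach S y z → Reach S x z
  reach-trans r here           = r
  reach-trans r (fwd e e∈S r′) = fwd e e∈S (reach-trans r r′)
  reach-trans r (bwd e e∈S r′) = bwd e e∈S (reach-trans r r′)

  reach-sym : ∀ {S x y} → Reach S x y → Reach S y x
  reach-sym here          = here
  reach-sym (fwd e e∈S r) = reach-trans (bwd e e∈S here) (reach-sym r)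
  reach-sym (bwd e e∈S r) = reach-trans (fwd e e∈S here) (reach-sym r)

  connected-mono : ∀ {U S T} → S ⊆ T → Connected U S → Connected U T
  connected-mono S⊆T conn x y x∈U y∈U = reach-mono S⊆T (conn x y x∈U y∈U)

  hub-connected : ∀ {U S} v → (∀ x → x ∈ U → Reach S v x) → Connected U S
  hub-connected v reach x y x∈U y∈U = reach-trans (reach-sym (reach x x∈U)) (reach y y∈U)

  -- deleting an edge outside S changes nothing, so a 2-edge connected
  -- subgraph stays connected after deleting an arbitrary edge
  delete-any-edge : ∀ {U S} → TwoEC U S → ∀ e → Connected U (S - e)
  delete-any-edge {S = S} (_ , _ , conn , conn-e) e with e ∈? S
  ... | yes e∈S = conn-e e e∈S
  ... | no  e∉S = connected-mono S⊆S-e conn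
    where
    S⊆S-e : S ⊆ S - e
    S⊆S-e f∈S = x∈p∧x≢y⇒x∈p-y f∈S (λ f≡e → e∉S (subst (_∈ S) f≡e f∈S))

  weightIn : Subset m → Fin m → ℕ
  weightIn S e = if lookup S e then cst e else 0

  cost-mono : ∀ {S T} → S ⊆ T → cost S ℕ.≤ cost T
  cost-mono {S} {T} S⊆T = ∑-mono weight≤
    where
    weight≤ : ∀ e → weightIn S e ℕ.≤ weightIn T e
    weight≤ e with lookup S e in e∈S
    ... | false = ℕ.z≤n
    ... | true rewrite ∈⇒lookup (S⊆T (lookup⇒∈ e∈S)) = ℕ.≤-refl

  cost-∪-∩ : ∀ p q → cost (p ∪ q) ℕ.+ cost (p ∩ q) ≡ cost p ℕ.+ cost q
  cost-∪-∩ p q = begin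
    cost (p ∪ q) ℕ.+ cost (p ∩ q)                          ≡⟨ sym (∑-+ (weightIn (p ∪ q)) (weightIn (p ∩ q))) ⟩
    ∑ (λ e → weightIn (p ∪ q) e ℕ.+ weightIn (p ∩ q) e)   ≡⟨ cong sum (tabulate-cong pointwise) ⟩
    ∑ (λ e → weightIn p e ℕ.+ weightIn q e)               ≡⟨ ∑-+ (weightIn p) (weightIn q) ⟩
    cost p ℕ.+ cost q                                       ∎
    where
    open ≡-Reasoning
    pointwise : ∀ e → weightIn (p ∪ q) e ℕ.+ weightIn (p ∩ q) e ≡ weightIn p e ℕ.+ weightIn q e
    pointwise e rewrite lookup-zipWith _∨_ e p q | lookup-zipWith _∧_ e p q with lookup p e | lookup q e
    ... | false | false = refl
    ... | false | true  = ℕ.+-identityʳ (cst e)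
    ... | true  | false = refl
    ... | true  | true  = refl

  cost-⊥ : cost ⊥ ≡ 0
  cost-⊥ = trans (cong sum (tabulate-cong (λ e → cong (λ b → if b then cst e else 0) (lookup-replicate e false)))) (∑-zero {m})

  cost-∪ : ∀ p q → cost (p ∪ q) ℕ.≤ cost p ℕ.+ cost q
  cost-∪ p q = subst (cost (p ∪ q) ℕ.≤_) (cost-∪-∩ p q) (ℕ.m≤m+n (cost (p ∪ q)) (cost (p ∩ q)))

  cost-∪-disjoint : ∀ p q → (∀ {e} → e ∈ p → e ∉ q) → cost (p ∪ q) ≡ cost p ℕ.+ cost q
  cost-∪-disjoint p q disjoint = begin
    cost (p ∪ q)                  ≡⟨ sym (ℕ.+-identityʳ _) ⟩
    cost (p ∪ q) ℕ.+ 0            ≡⟨ cong (cost (p ∪ q) ℕ.+_) (trans (cong cost p∩q≡⊥) cost-⊥) ⟨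
    cost (p ∪ q) ℕ.+ cost (p ∩ q) ≡⟨ cost-∪-∩ p q ⟩
    cost p ℕ.+ cost q             ∎
    where
    open ≡-Reasoning
    p∩q≡⊥ : p ∩ q ≡ ⊥
    p∩q≡⊥ = Empty-unique (λ { (e , e∈p∩q) → let (e∈p , e∈q) = x∈p∩q⁻ p q e∈p∩q in disjoint e∈p e∈q })

  ∈⋃ᶠ⁺ : ∀ {k} (F : Fin k → Subset m) i {e} → e ∈ F i → e ∈ ⋃ᶠ F
  ∈⋃ᶠ⁺ F zero    e∈F = x∈p∪q⁺ (inj₁ e∈F)
  ∈⋃ᶠ⁺ F (suc i) e∈F = x∈p∪q⁺ (inj₂ (∈⋃ᶠ⁺ (F ∘ suc) i e∈F))

  ∈⋃ᶠ⁻ : ∀ {k} (F : Fin k → Subset m) {e} → e ∈ ⋃ᶠ F → ∃[ i ] e ∈ F i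
  ∈⋃ᶠ⁻ {ℕ.zero}  F e∈⋃ = ⊥-elim (∉⊥ e∈⋃)
  ∈⋃ᶠ⁻ {ℕ.suc k} F e∈⋃ with x∈p∪q⁻ (F zero) (⋃ᶠ (F ∘ suc)) e∈⋃
  ... | inj₁ e∈F₀ = zero , e∈F₀
  ... | inj₂ e∈⋃′ with ∈⋃ᶠ⁻ (F ∘ suc) e∈⋃′
  ... | i , e∈Fi = suc i , e∈Fi

  ⋃ᶠ-⊆ : ∀ {k} (F : Fin k → Subset m) {S} → (∀ i → F i ⊆ S) → ⋃ᶠ F ⊆ S
  ⋃ᶠ-⊆ F F⊆S e∈⋃ with ∈⋃ᶠ⁻ F e∈⋃
  ... | i , e∈Fi = F⊆S i e∈Fi

  cost-⋃ᶠ : ∀ {k} (F : Fin k → Subset m) → cost (⋃ᶠ F) ℕ.≤ ∑ (cost ∘ F)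
  cost-⋃ᶠ {ℕ.zero}  F = ℕ.≤-reflexive cost-⊥
  cost-⋃ᶠ {ℕ.suc k} F = ℕ.≤-trans (cost-∪ (F zero) (⋃ᶠ (F ∘ suc)))
                                  (ℕ.+-monoʳ-≤ (cost (F zero)) (cost-⋃ᶠ (F ∘ suc)))

  cost-⋃ᶠ-disjoint : ∀ {k} (F : Fin k → Subset m) →
    (∀ {i j e} → i ≢ j → e ∈ F i → e ∉ F j) → cost (⋃ᶠ F) ≡ ∑ (cost ∘ F)
  cost-⋃ᶠ-disjoint {ℕ.zero}  F disjoint = cost-⊥
  cost-⋃ᶠ-disjoint {ℕ.suc k} F disjoint = begin
    cost (F zero ∪ ⋃ᶠ (F ∘ suc))            ≡⟨ cost-∪-disjoint (F zero) (⋃ᶠ (F ∘ suc)) F₀-apart ⟩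
    cost (F zero) ℕ.+ cost (⋃ᶠ (F ∘ suc))   ≡⟨ cong (cost (F zero) ℕ.+_) (cost-⋃ᶠ-disjoint (F ∘ suc) (disjoint ∘ suc≢suc)) ⟩
    cost (F zero) ℕ.+ ∑ (cost ∘ F ∘ suc)    ∎
    where
    open ≡-Reasoning
    suc≢suc : ∀ {i j : Fin k} → i ≢ j → suc i ≢ suc j
    suc≢suc i≢j refl = i≢j refl
    F₀-apart : ∀ {e} → e ∈ F zero → e ∉ ⋃ᶠ (F ∘ suc)
    F₀-apart e∈F₀ e∈⋃ with ∈⋃ᶠ⁻ (F ∘ suc) e∈⋃
    ... | j , e∈Fj = disjoint (λ ()) e∈F₀ e∈Fj

  ∈inducedEdges⁻ : ∀ U {e} → e ∈ inducedEdges U → src e ∈ U × tgt e ∈ U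
  ∈inducedEdges⁻ U {e} e∈ =
    lookup⇒∈ (∧-conicalˡ _ _ both) , lookup⇒∈ (∧-conicalʳ _ _ both)
    where
    both : lookup U (src e) ∧ lookup U (tgt e) ≡ true
    both = trans (sym (lookup∘tabulate _ e)) (∈⇒lookup e∈)

  ∈inducedEdges⁺ : ∀ U {e} → src e ∈ U → tgt e ∈ U → e ∈ inducedEdges U
  ∈inducedEdges⁺ U {e} s∈U t∈U =
    lookup⇒∈ (trans (lookup∘tabulate _ e) (cong₂ _∧_ (∈⇒lookup s∈U) (∈⇒lookup t∈U)))

  ∈edgesAvoiding⁺ : ∀ v {e} → src e ≢ v → tgt e ≢ v → e ∈ edgesAvoiding v
  ∈edgesAvoiding⁺ v {e} s≢v t≢v = lookup⇒∈ (trans (lookup∘tabulate _ e) avoids)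
    where
    avoids : (if ⌊ src e ≟ v ⌋ then false else if ⌊ tgt e ≟ v ⌋ then false else true) ≡ true
    avoids with src e ≟ v | tgt e ≟ v
    ... | yes s≡v | _       = ⊥-elim (s≢v s≡v)
    ... | no _    | yes t≡v = ⊥-elim (t≢v t≡v)
    ... | no _    | no _    = refl

  v∈block : ∀ v C → v ∈ blockNodes v C
  v∈block v C = x∈p∪q⁺ (inj₁ (x∈⁅x⁆ v))

  C⊆block : ∀ v C → C ⊆ blockNodes v C
  C⊆block v C x∈C = x∈p∪q⁺ (inj₂ x∈C)

  block⇒component : ∀ {v C x} → x ∈ blockNodes v C → x ≢ v → x ∈ C
  block⇒component {v} {C} x∈B x≢v with x∈p∪q⁻ ⁅ v ⁆ C x∈B
  ... | inj₁ x∈⁅v⁆ = ⊥-elim (x≢v (x∈⁅y⁆⇒x≡y v x∈⁅v⁆))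
  ... | inj₂ x∈C   = x∈C

  components-meet : ∀ {v C D x} → IsComponent v C → IsComponent v D → x ∈ C → x ∈ D → C ≡ D
  components-meet {x = x} (_ , _ , connC , closedC) (_ , _ , connD , closedD) x∈C x∈D =
    ⊆-antisym (λ {y} y∈C → closedD x y x∈D (connC x y x∈C y∈C))
              (λ {y} y∈D → closedC x y x∈C (connD x y x∈D y∈D))

  module Restriction {v : Fin n} {C : Subset n} (isComponent : IsComponent v C) where

    B : Subset n
    B = blockNodes v C

    E : Subset m
    E = inducedEdges B

    -- an edge leaving the block leaves it at v, since C is closed in G - v
    exit-at-cut : ∀ {a b} → a ∈ B → b ∉ B →
      (a ≢ v → b ≢ v → Reach (edgesAvoiding v) a b) → a ≡ v
    exit-at-cut {a} {b} a∈B b∉B a↝b with a ≟ v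
    ... | yes a≡v = a≡v
    ... | no  a≢v = ⊥-elim (b∉B (C⊆block v C (closed a b (block⇒component a∈B a≢v) (a↝b a≢v b≢v))))
      where
      closed : ∀ x y → x ∈ C → Reach (edgesAvoiding v) x y → y ∈ C
      closed = proj₂ (proj₂ (proj₂ isComponent))
      b≢v : b ≢ v
      b≢v b≡v = b∉B (subst (_∈ B) (sym b≡v) (v∈block v C))

    clip : Fin n → Fin n
    clip x with x ∈? B
    ... | yes _ = x
    ... | no  _ = v

    clip-block : ∀ {x} → x ∈ B → clip x ≡ x
    clip-block {x} x∈B with x ∈? B
    ... | yes _   = refl
    ... | no  x∉B = ⊥-elim (x∉B x∈B)

    clip-edge : ∀ {S} e → e ∈ S → Reach (S ∩ E) (clip (src e)) (clip (tgt e))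
    clip-edge {S} e e∈S with src e ∈? B | tgt e ∈? B
    ... | yes s∈B | yes t∈B = fwd e (x∈p∩q⁺ (e∈S , ∈inducedEdges⁺ B s∈B t∈B)) here
    ... | yes s∈B | no  t∉B =
      subst (λ a → Reach (S ∩ E) a v)
            (sym (exit-at-cut s∈B t∉B (λ s≢v t≢v → fwd e (∈edgesAvoiding⁺ v s≢v t≢v) here))) here
    ... | no  s∉B | yes t∈B =
      subst (Reach (S ∩ E) v)
            (sym (exit-at-cut t∈B s∉B (λ t≢v s≢v → bwd e (∈edgesAvoiding⁺ v s≢v t≢v) here))) here
    ... | no  _   | no  _   = here

    clip-walk : ∀ {S x y} → Reach S x y → Reach (S ∩ E) (clip x) (clip y)
    clip-walk here          = here
    clip-walk (fwd e e∈S r) = reach-trans (clip-walk r) (clip-edge e e∈S)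
    clip-walk (bwd e e∈S r) = reach-trans (clip-walk r) (reach-sym (clip-edge e e∈S))

    restrict-connected : ∀ {S} → Connected ⊤ S → Connected B (S ∩ E)
    restrict-connected conn x y x∈B y∈B =
      subst₂ (Reach _) (clip-block x∈B) (clip-block y∈B) (clip-walk (conn x y ∈⊤ ∈⊤))

    restrict-2ECSS : ∀ {T} → TwoEC ⊤ T → IsTwoECSS B E (T ∩ E)
    restrict-2ECSS {T} (_ , _ , conn , conn-e) =
      p∩q⊆q T E ,
      (λ e e∈ → ∈inducedEdges⁻ B (p∩q⊆q T E e∈)) ,
      (v , x₀ , v∈block v C , C⊆block v C x₀∈C , v≢x₀) ,
      restrict-connected conn ,
      (λ e e∈ → connected-mono (-∩⊆∩- T E e)
                  (restrict-connected (conn-e e (proj₁ (x∈p∩q⁻ T E e∈)))))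
      where
      x₀ : Fin n
      x₀ = proj₁ (proj₁ (proj₂ isComponent))
      x₀∈C : x₀ ∈ C
      x₀∈C = proj₂ (proj₁ (proj₂ isComponent))
      v≢x₀ : v ≢ x₀
      v≢x₀ v≡x₀ = proj₁ isComponent (subst (_∈ C) (sym v≡x₀) x₀∈C)

  module Decomposition {v : Fin n} {k : ℕ} {C : Fin k → Subset n}
                       (enum : EnumComponents v k C) where

    block : Fin k → Subset n
    block i = blockNodes v (C i)

    blockEdges : Fin k → Subset m
    blockEdges i = inducedEdges (block i)

    same-block : ∀ {i j w} → w ≢ v → w ∈ block i → w ∈ block j → i ≡ j
    same-block {i} {j} w≢v w∈i w∈j =
      proj₁ (proj₂ enum) i j
        (components-meet (proj₁ enum i) (proj₁ enum j)
                         (block⇒component w∈i w≢v) (block⇒component w∈j w≢v))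

    -- in a loop-free graph distinct blocks share no edge, since an edge
    -- has an end other than v
    blockEdges-disjoint : (∀ e → src e ≢ tgt e) →
      ∀ {i j e} → i ≢ j → e ∈ blockEdges i → e ∉ blockEdges j
    blockEdges-disjoint loopless {i} {j} {e} i≢j e∈Ei e∈Ej
      with src e ≟ v | ∈inducedEdges⁻ (block i) e∈Ei | ∈inducedEdges⁻ (block j) e∈Ej
    ... | no  s≢v | s∈i , _   | s∈j , _   = i≢j (same-block s≢v s∈i s∈j)
    ... | yes s≡v | _   , t∈i | _   , t∈j = i≢j (same-block t≢v t∈i t∈j)
      where
      t≢v : tgt e ≢ v
      t≢v t≡v = loopless e (trans s≡v (sym t≡v))

    reach-from-cut : ∀ {S} (F : Fin k → Subset m) →
      (∀ i → Connected (block i) (F i)) → (∀ i → F i ⊆ S) → ∀ x → Reach S v x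
    reach-from-cut F conn F⊆S x with x ≟ v
    ... | yes refl = here
    ... | no  x≢v with proj₂ (proj₂ enum) x x≢v
    ... | i , x∈Ci = reach-mono (F⊆S i) (conn i v x (v∈block v (C i)) (C⊆block v (C i) x∈Ci))

    union-2ECSS : TwoEC ⊤ ⊤ → (B' : Fin k → Subset m) →
      (∀ i → IsTwoECSS (block i) (blockEdges i) (B' i)) → IsTwoECSS ⊤ ⊤ (⋃ᶠ B')
    union-2ECSS (_ , twoNodes , _) B' B'-2ECSS =
      ⊆⊤ , (λ _ _ → ∈⊤ , ∈⊤) , twoNodes ,
      hub-connected v (λ x _ → reach-from-cut B' (conn ∘ proj₂ ∘ B'-2ECSS) (∈⋃ᶠ⁺ B') x) ,
      (λ e _ → hub-connected v (λ x _ →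
         reach-from-cut (λ i → B' i - e) (λ i → delete-any-edge (proj₂ (B'-2ECSS i)) e)
                        (λ i → -‿monoˡ (∈⋃ᶠ⁺ B' i)) x))
      where
      conn : ∀ {U S} → TwoEC U S → Connected U S
      conn = proj₁ ∘ proj₂ ∘ proj₂

    -- Σ opt(Bᵢ) ≤ opt(G): a 2-ECSS of G splits into edge-disjoint 2-ECSSs of the blocks
    ∑-block-opt≤ : (∀ e → src e ≢ tgt e) → (o : Fin k → ℕ) →
      (∀ i T → IsTwoECSS (block i) (blockEdges i) T → o i ℕ.≤ cost T) →
      ∀ T → TwoEC ⊤ T → ∑ o ℕ.≤ cost T
    ∑-block-opt≤ loopless o o-minimal T T-2EC = begin
      ∑ o                      ≤⟨ ∑-mono (λ i → o-minimal i (part i) (Restriction.restrict-2ECSS (proj₁ enum i) T-2EC)) ⟩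
      ∑ (cost ∘ part)          ≡⟨ cost-⋃ᶠ-disjoint part parts-disjoint ⟨
      cost (⋃ᶠ part)           ≤⟨ cost-mono (⋃ᶠ-⊆ part (λ i → p∩q⊆p T (blockEdges i))) ⟩
      cost T                   ∎
      where
      open ℕ.≤-Reasoning
      part : Fin k → Subset m
      part i = T ∩ blockEdges i
      parts-disjoint : ∀ {i j e} → i ≢ j → e ∈ part i → e ∉ part j
      parts-disjoint i≢j e∈i e∈j =
        blockEdges-disjoint loopless i≢j (p∩q⊆q T _ e∈i) (p∩q⊆q T _ e∈j)

open CostBound using (fromℕ-mono; bound-mono; bound-∑)

lemma14 : (α : ℚ) → (+ 5 / 3) ≤ α →
    {n m : ℕ} (ends : Fin m → Fin n × Fin n) (cst : Fin m → ℕ) →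
    let open Graph ends cst in
    IsMAP →
    (v : Fin n) → IsCutNode v →
    (k : ℕ) (C : Fin k → Subset n) → EnumComponents v k C →
    (B' : Fin k → Subset m) →
    (∀ i → IsTwoECSS (blockNodes v (C i)) (inducedEdges (blockNodes v (C i))) (B' i)) →
    (∀ i → ∃[ o ] (IsOpt (blockNodes v (C i)) (inducedEdges (blockNodes v (C i))) o ×
                    fromℕ (cost (B' i)) ≤ bound α o)) →
    IsTwoECSS ⊤ ⊤ (⋃ᶠ B') ×
    (∀ o → IsOpt ⊤ ⊤ o → fromℕ (cost (⋃ᶠ B')) ≤ bound α o)
lemma14 α 5/3≤α ends cst (loopless , _ , _ , G-2EC) v _ k C enum B' B'-2ECSS B'-bounded =
  union-2ECSS G-2EC B' B'-2ECSS , cost-bound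
  where
  open Graph ends cst
  open GraphFacts ends cst using (cost-⋃ᶠ; module Decomposition)
  open Decomposition enum
  1≤α : ℚ.1ℚ ≤ α
  1≤α = ℚ.≤-trans (ℚ.≤ᵇ⇒≤ _) 5/3≤α
  0≤α : ℚ.0ℚ ≤ α
  0≤α = ℚ.≤-trans (ℚ.≤ᵇ⇒≤ _) 1≤α
  optᵢ : Fin k → ℕ
  optᵢ i = proj₁ (B'-bounded i)
  optᵢ-minimal : ∀ i T → IsTwoECSS (block i) (blockEdges i) T → optᵢ i ℕ.≤ cost T
  optᵢ-minimal i = proj₂ (proj₁ (proj₂ (B'-bounded i)))
  cost-bound : ∀ o → IsOpt ⊤ ⊤ o → fromℕ (cost (⋃ᶠ B')) ≤ bound α o
  cost-bound o ((T , (_ , T-2EC) , cost-T≡o) , _) = begin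
    fromℕ (cost (⋃ᶠ B'))  ≤⟨ fromℕ-mono (cost-⋃ᶠ B') ⟩
    fromℕ (∑ (cost ∘ B')) ≤⟨ bound-∑ 1≤α (cost ∘ B') optᵢ (proj₂ ∘ proj₂ ∘ B'-bounded) ⟩
    bound α (∑ optᵢ)      ≤⟨ bound-mono 0≤α opt-split ⟩
    bound α o             ∎
    where
    open ℚ.≤-Reasoning
    opt-split : ∑ optᵢ ℕ.≤ o
    opt-split = ℕ.≤-trans (∑-block-opt≤ loopless optᵢ optᵢ-minimal T T-2EC) (ℕ.≤-reflexive cost-T≡o)
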